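{- For every $\ell \in \mathbb{Z}$ and every integer $n \geq 2$, \[ \frac{\ell^{n}-(\ell-1)^{n}}{n} \notin \mathbb{Z}. \] -}

module Defs where

module Submission where

open import Defs
open import Data.Nat using (ℕ; _≥_)
open import Data.Integer using (ℤ; +_; _-_; _^_; 1ℤ)
open import Data.Integer.Divisibility using (_∣_)
open import Relation.Nullary using (¬_)

open import Data.Nat as ℕ using (zero; suc; s≤s; _<_; _≤_; _∸_)
import Data.Nat.Properties as ℕ
open import Data.Nat.Divisibility as ℕ∣ using (_∣?_; hasNonTrivialDivisor)
open import Data.Nat.GCD using (gcd; gcd-GCD; gcd[m,n]∣m; gcd[m,n]≤n; gcd[m,n]≢0; module Bézout)
open import Data.Nat.Primality
  using (Prime; _Rough_; 2-rough; ∤⇒rough-suc; rough∧∣⇒prime; euclidsLemma; ¬prime[0]; ¬prime[1])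
open import Data.Integer using (_+_; _*_; -_; 0ℤ; ∣_∣)
import Data.Integer.Properties as ℤ
open import Data.Integer.DivMod using (_%ℕ_; _/ℕ_; n%ℕd<d; a≡a%ℕn+[a/ℕn]*n)
open import Data.Integer.Divisibility.Signed as Signed using (divides) renaming (_∣_ to _∣ₛ_)
open import Data.Integer.Tactic.RingSolver using (solve-∀)
open import Data.Fin as Fin using (Fin; toℕ; fromℕ<; punchOut)
open import Data.Fin.Properties using (toℕ-fromℕ<; toℕ<n; pigeonhole; punchOut-injective)
open import Data.Product using (∃-syntax; _×_; _,_)
open import Data.Sum using (_⊎_; inj₁; inj₂)
open import Function using (_∘_)
open import Relation.Nullary using (yes; no; contradiction)
open import Relation.Binary.PropositionalEquality

-- Let p be the smallest prime factor of n, and suppose p ∣ aⁿ - bⁿ where a - b = 1.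
-- Then p divides neither a nor b, and the exponents d with aᵈ ≡ bᵈ (mod p) are closed
-- under sums and differences, hence under gcd (Bézout).  By the pigeonhole principle
-- on the p-1 nonzero residues, some 0 < d < p is such an exponent, so gcd n d is one
-- too; it divides n and is smaller than p, so it is 1.  Hence p ∣ a - b = 1.

rough∧∣∧<⇒≡1 : ∀ {m n d} → m Rough n → d ℕ∣.∣ n → d < m → d ≢ 0 → d ≡ 1
rough∧∣∧<⇒≡1 {d = zero}        _     _   _   d≢0 = contradiction refl d≢0
rough∧∣∧<⇒≡1 {d = suc zero}    _     _   _   _   = refl
rough∧∣∧<⇒≡1 {d = suc (suc _)} rough d∣n d<m _   = contradiction (hasNonTrivialDivisor d<m d∣n) rough

roughPrimeFactorFrom : ∀ k {t n} → k ℕ.+ suc (suc t) ≡ n → suc (suc t) Rough n →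
                       ∃[ p ] Prime p × p Rough n × p ℕ∣.∣ n
roughPrimeFactorFrom k {t} {n} eq rough with suc (suc t) ∣? n
... | yes p∣n = suc (suc t) , rough∧∣⇒prime rough p∣n , rough , p∣n
roughPrimeFactorFrom zero    refl rough | no p∤n = contradiction ℕ∣.∣-refl p∤n
roughPrimeFactorFrom (suc k) eq   rough | no p∤n =
  roughPrimeFactorFrom k (trans (ℕ.+-suc k _) eq) (∤⇒rough-suc p∤n rough)

smallestPrimeFactor : ∀ {n} → 2 ≤ n → ∃[ p ] Prime p × p Rough n × p ℕ∣.∣ n
smallestPrimeFactor {n} 2≤n = roughPrimeFactorFrom (n ∸ 2) (ℕ.m∸n+n≡m 2≤n) 2-rough

module _ {p : ℕ} (p-prime : Prime p) where

  prime∤1 : ¬ (+ p ∣ₛ 1ℤ)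
  prime∤1 p∣1 with ℕ∣.∣1⇒≡1 (Signed.∣⇒∣ᵤ p∣1)
  ... | refl = ¬prime[1] p-prime

  euclidsLemmaℤ : ∀ x y → + p ∣ₛ x * y → + p ∣ₛ x ⊎ + p ∣ₛ y
  euclidsLemmaℤ x y p∣xy
    with euclidsLemma ∣ x ∣ ∣ y ∣ p-prime (subst (p ℕ∣.∣_) (ℤ.abs-* x y) (Signed.∣⇒∣ᵤ p∣xy))
  ... | inj₁ p∣x = inj₁ (Signed.∣ᵤ⇒∣ p∣x)
  ... | inj₂ p∣y = inj₂ (Signed.∣ᵤ⇒∣ p∣y)

  ∤∧∤⇒∤* : ∀ {x y} → ¬ (+ p ∣ₛ x) → ¬ (+ p ∣ₛ y) → ¬ (+ p ∣ₛ x * y)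
  ∤∧∤⇒∤* {x} {y} p∤x p∤y p∣xy with euclidsLemmaℤ x y p∣xy
  ... | inj₁ p∣x = p∤x p∣x
  ... | inj₂ p∣y = p∤y p∣y

  ∤∧∣*⇒∣ : ∀ {x y} → ¬ (+ p ∣ₛ x) → + p ∣ₛ x * y → + p ∣ₛ y
  ∤∧∣*⇒∣ {x} {y} p∤x p∣xy with euclidsLemmaℤ x y p∣xy
  ... | inj₁ p∣x = contradiction p∣x p∤x
  ... | inj₂ p∣y = p∣y

  ∤⇒∤^ : ∀ {x} → ¬ (+ p ∣ₛ x) → ∀ k → ¬ (+ p ∣ₛ x ^ k)
  ∤⇒∤^ p∤x zero    = prime∤1
  ∤⇒∤^ p∤x (suc k) = ∤∧∤⇒∤* p∤x (∤⇒∤^ p∤x k)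

  ∣^⇒∣ : ∀ {x} k → + p ∣ₛ x ^ suc k → + p ∣ₛ x
  ∣^⇒∣ {x} k p∣xᵏ⁺¹ with euclidsLemmaℤ x (x ^ k) p∣xᵏ⁺¹
  ... | inj₁ p∣x = p∣x
  ∣^⇒∣ zero    _ | inj₂ p∣1  = contradiction p∣1 prime∤1
  ∣^⇒∣ (suc k) _ | inj₂ p∣xᵏ = ∣^⇒∣ k p∣xᵏ

^-difference-+ : ∀ a b j k → a ^ (j ℕ.+ k) - b ^ (j ℕ.+ k) ≡ a ^ k * (a ^ j - b ^ j) + b ^ j * (a ^ k - b ^ k)
^-difference-+ a b j k = begin
  a ^ (j ℕ.+ k) - b ^ (j ℕ.+ k)                     ≡⟨ cong₂ _-_ (ℤ.^-distribˡ-+-* a j k) (ℤ.^-distribˡ-+-* b j k) ⟩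
  a ^ j * a ^ k - b ^ j * b ^ k                     ≡⟨ regroup (a ^ j) (b ^ j) (a ^ k) (b ^ k) ⟩
  a ^ k * (a ^ j - b ^ j) + b ^ j * (a ^ k - b ^ k) ∎
  where
  open ≡-Reasoning
  regroup : ∀ A B X Y → A * X - B * Y ≡ X * (A - B) + B * (X - Y)
  regroup = solve-∀

module Periods {p : ℕ} (p-prime : Prime p) (a b : ℤ) where

  -- The exponents d with aᵈ ≡ bᵈ (mod p); when p ∤ b they are the multiples of the order of a/b.
  Period : ℕ → Set
  Period d = + p ∣ₛ a ^ d - b ^ d

  period-0 : Period 0
  period-0 = divides 0ℤ refl

  period-+ : ∀ {j k} → Period j → Period k → Period (j ℕ.+ k)
  period-+ {j} {k} pⱼ pₖ = subst (+ p ∣ₛ_) (sym (^-difference-+ a b j k))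
    (Signed.∣m∣n⇒∣m+n (Signed.∣n⇒∣m*n (a ^ k) pⱼ) (Signed.∣n⇒∣m*n (b ^ j) pₖ))

  period-* : ∀ q {d} → Period d → Period (q ℕ.* d)
  period-* zero        _  = period-0
  period-* (suc q) {d} pd = period-+ {d} {q ℕ.* d} pd (period-* q pd)

  period-cancel : ¬ (+ p ∣ₛ a) → ∀ {j k} → Period (j ℕ.+ k) → Period k → Period j
  period-cancel p∤a {j} {k} pⱼ₊ₖ pₖ = ∤∧∣*⇒∣ p-prime (∤⇒∤^ p-prime p∤a k)
    (Signed.∣m+n∣n⇒∣m (subst (+ p ∣ₛ_) (^-difference-+ a b j k) pⱼ₊ₖ) (Signed.∣n⇒∣m*n (b ^ j) pₖ))

  period-bézout : ¬ (+ p ∣ₛ a) → ∀ {g m n} → Bézout.Identity g m n → Period m → Period n → Period g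
  period-bézout p∤a {g} {m} {n} (Bézout.+- x y eq) pₘ pₙ =
    period-cancel p∤a {g} {y ℕ.* n} (subst Period (sym eq) (period-* x pₘ)) (period-* y pₙ)
  period-bézout p∤a {g} {m} {n} (Bézout.-+ x y eq) pₘ pₙ =
    period-cancel p∤a {g} {x ℕ.* m} (subst Period (sym eq) (period-* y pₙ)) (period-* x pₘ)

  period-gcd : ¬ (+ p ∣ₛ a) → ∀ {m n} → Period m → Period n → Period (gcd m n)
  period-gcd p∤a {m} {n} = period-bézout p∤a (Bézout.identity (gcd-GCD m n))

  collision⇒period : ¬ (+ p ∣ₛ a) → ¬ (+ p ∣ₛ b) → ∀ i k c →
                     + p ∣ₛ a ^ (i ℕ.+ k) * b ^ c - a ^ i * b ^ (k ℕ.+ c) → Period k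
  collision⇒period p∤a p∤b i k c p∣diff =
    ∤∧∣*⇒∣ p-prime (∤∧∤⇒∤* p-prime (∤⇒∤^ p-prime p∤a i) (∤⇒∤^ p-prime p∤b c)) (subst (+ p ∣ₛ_) factorise p∣diff)
    where
    open ≡-Reasoning
    regroup : ∀ A C X Y → (A * X) * C - A * (Y * C) ≡ (A * C) * (X - Y)
    regroup = solve-∀
    factorise : a ^ (i ℕ.+ k) * b ^ c - a ^ i * b ^ (k ℕ.+ c) ≡ (a ^ i * b ^ c) * (a ^ k - b ^ k)
    factorise = begin
      a ^ (i ℕ.+ k) * b ^ c - a ^ i * b ^ (k ℕ.+ c)
        ≡⟨ cong₂ (λ s t → s * b ^ c - a ^ i * t) (ℤ.^-distribˡ-+-* a i k) (ℤ.^-distribˡ-+-* b k c) ⟩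
      (a ^ i * a ^ k) * b ^ c - a ^ i * (b ^ k * b ^ c)
        ≡⟨ regroup (a ^ i) (b ^ c) (a ^ k) (b ^ k) ⟩
      (a ^ i * b ^ c) * (a ^ k - b ^ k) ∎

  collision⇒period-∸ : ¬ (+ p ∣ₛ a) → ¬ (+ p ∣ₛ b) → ∀ {i j l} → i ≤ j → j ≤ l →
                       + p ∣ₛ a ^ j * b ^ (l ∸ j) - a ^ i * b ^ (l ∸ i) → Period (j ∸ i)
  collision⇒period-∸ p∤a p∤b {i} i≤j j≤l
    with k , refl ← ℕ.m≤n⇒∃[o]m+o≡n i≤j | c , refl ← ℕ.m≤n⇒∃[o]m+o≡n j≤l
    rewrite ℕ.m+n∸m≡n i k | ℕ.m+n∸m≡n (i ℕ.+ k) c | ℕ.+-assoc i k c | ℕ.m+n∸m≡n i (k ℕ.+ c)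
    = collision⇒period p∤a p∤b i k c

  period⇒∣a⇒∣b : ∀ k → Period (suc k) → + p ∣ₛ a → + p ∣ₛ b
  period⇒∣a⇒∣b k pₖ₊₁ p∣a = ∣^⇒∣ p-prime k
    (subst (+ p ∣ₛ_) (ℤ.neg-involutive (b ^ suc k))
      (Signed.∣m⇒∣-m (Signed.∣m+n∣m⇒∣n pₖ₊₁ (Signed.∣m⇒∣m*n (a ^ k) p∣a))))

  period⇒∣b⇒∣a : ∀ k → Period (suc k) → + p ∣ₛ b → + p ∣ₛ a
  period⇒∣b⇒∣a k pₖ₊₁ p∣b = ∣^⇒∣ p-prime k
    (Signed.∣m+n∣n⇒∣m pₖ₊₁ (Signed.∣m⇒∣-m (Signed.∣m⇒∣m*n (b ^ k) p∣b)))

  period-1⇒∣- : Period 1 → + p ∣ₛ a - b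
  period-1⇒∣- = subst (+ p ∣ₛ_) (cong₂ _-_ (ℤ.^-identityʳ a) (ℤ.^-identityʳ b))

module _ {m : ℕ} where

  residue : ℤ → Fin (suc m)
  residue x = fromℕ< (n%ℕd<d x (suc m))

  residue-≡⇒∣- : ∀ x y → residue x ≡ residue y → + suc m ∣ₛ x - y
  residue-≡⇒∣- x y eq = divides (qₓ - q_y) (begin
    x - y                                      ≡⟨ cong₂ _-_ (a≡a%ℕn+[a/ℕn]*n x (suc m)) (a≡a%ℕn+[a/ℕn]*n y (suc m)) ⟩
    (+ rₓ + qₓ * + suc m) - (+ r_y + q_y * + suc m) ≡⟨ cong (λ r → (+ rₓ + qₓ * + suc m) - (+ r + q_y * + suc m)) (sym rₓ≡r_y) ⟩
    (+ rₓ + qₓ * + suc m) - (+ rₓ + q_y * + suc m)  ≡⟨ cancel (+ rₓ) qₓ q_y (+ suc m) ⟩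
    (qₓ - q_y) * + suc m                            ∎)
    where
    open ≡-Reasoning
    rₓ r_y : ℕ
    rₓ  = x %ℕ suc m
    r_y = y %ℕ suc m
    qₓ q_y : ℤ
    qₓ  = x /ℕ suc m
    q_y = y /ℕ suc m
    rₓ≡r_y : rₓ ≡ r_y
    rₓ≡r_y = trans (sym (toℕ-fromℕ< _)) (trans (cong toℕ eq) (toℕ-fromℕ< _))
    cancel : ∀ R Q₁ Q₂ P → (R + Q₁ * P) - (R + Q₂ * P) ≡ (Q₁ - Q₂) * P
    cancel = solve-∀

  ∤⇒residue≢0 : ∀ {x} → ¬ (+ suc m ∣ₛ x) → Fin.zero ≢ residue x
  ∤⇒residue≢0 {x} p∤x 0≡r = p∤x (subst (+ suc m ∣ₛ_) (ℤ.+-identityʳ x) (residue-≡⇒∣- x 0ℤ (sym 0≡r)))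

  -- Punching out the residue 0 renumbers the p - 1 nonzero residues as Fin (p - 1).
  unitResidue : ∀ {x} → ¬ (+ suc m ∣ₛ x) → Fin m
  unitResidue p∤x = punchOut (∤⇒residue≢0 p∤x)

  unitResidue-≡⇒∣- : ∀ {x y} (p∤x : ¬ (+ suc m ∣ₛ x)) (p∤y : ¬ (+ suc m ∣ₛ y)) →
                     unitResidue p∤x ≡ unitResidue p∤y → + suc m ∣ₛ x - y
  unitResidue-≡⇒∣- {x} {y} p∤x p∤y eq =
    residue-≡⇒∣- x y (punchOut-injective (∤⇒residue≢0 p∤x) (∤⇒residue≢0 p∤y) eq)

module CoprimeBases {m : ℕ} (p-prime : Prime (suc m)) {a b : ℤ}
                    (p∤a : ¬ (+ suc m ∣ₛ a)) (p∤b : ¬ (+ suc m ∣ₛ b)) where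
  open Periods p-prime a b

  -- Two of these p units share a residue, and aʲbᵐ⁻ʲ - aⁱbᵐ⁻ⁱ = aⁱbᵐ⁻ʲ(aʲ⁻ⁱ - bʲ⁻ⁱ).
  term : Fin (suc m) → ℤ
  term i = a ^ toℕ i * b ^ (m ∸ toℕ i)

  p∤term : ∀ i → ¬ (+ suc m ∣ₛ term i)
  p∤term i = ∤∧∤⇒∤* p-prime (∤⇒∤^ p-prime p∤a (toℕ i)) (∤⇒∤^ p-prime p∤b (m ∸ toℕ i))

  toℕ≤m : ∀ (i : Fin (suc m)) → toℕ i ≤ m
  toℕ≤m i = ℕ.≤-pred (toℕ<n i)

  SmallPeriod : Set
  SmallPeriod = ∃[ d ] 0 < d × d < suc m × Period d

  collision⇒smallPeriod : ∀ {i j} → i Fin.< j → unitResidue (p∤term i) ≡ unitResidue (p∤term j) → SmallPeriod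
  collision⇒smallPeriod {i} {j} i<j eq =
      toℕ j ∸ toℕ i
    , ℕ.m<n⇒0<n∸m i<j
    , s≤s (ℕ.≤-trans (ℕ.m∸n≤m (toℕ j) (toℕ i)) (toℕ≤m j))
    , collision⇒period-∸ p∤a p∤b (ℕ.<⇒≤ i<j) (toℕ≤m j) (unitResidue-≡⇒∣- (p∤term j) (p∤term i) (sym eq))

  smallPeriod : SmallPeriod
  smallPeriod =
    let _ , _ , i<j , eq = pigeonhole (ℕ.n<1+n m) (unitResidue ∘ p∤term)
    in collision⇒smallPeriod i<j eq

  rough∧period⇒period-1 : ∀ {n} → suc m Rough n → Period n → Period 1
  rough∧period⇒period-1 {n} rough pₙ =
    let _ , 0<d , d<p , p_d = smallPeriod in gcd-period-1 0<d d<p p_d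
    where
    gcd-period-1 : ∀ {d} → 0 < d → d < suc m → Period d → Period 1
    gcd-period-1 {d@(suc _)} _ d<p p_d =
      subst Period
        (rough∧∣∧<⇒≡1 rough (gcd[m,n]∣m n d) (ℕ.≤-<-trans (gcd[m,n]≤n n d) d<p) (gcd[m,n]≢0 n d (inj₂ λ ())))
        (period-gcd p∤a {n} {d} pₙ p_d)

prime-rough⇒∤^-difference : ∀ {m k} → Prime (suc m) → suc m Rough suc k →
                            ∀ {a b} → a - b ≡ 1ℤ → ¬ (+ suc m ∣ₛ a ^ suc k - b ^ suc k)
prime-rough⇒∤^-difference {m} {k} p-prime rough {a} {b} a-b≡1 pₖ₊₁ =
  p∤a-b (period-1⇒∣- (rough∧period⇒period-1 rough pₖ₊₁))
  where
  open Periods p-prime a b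

  p∤a-b : ¬ (+ suc m ∣ₛ a - b)
  p∤a-b = prime∤1 p-prime ∘ subst (+ suc m ∣ₛ_) a-b≡1

  p∤a : ¬ (+ suc m ∣ₛ a)
  p∤a p∣a = p∤a-b (Signed.∣m∣n⇒∣m-n p∣a (period⇒∣a⇒∣b k pₖ₊₁ p∣a))

  p∤b : ¬ (+ suc m ∣ₛ b)
  p∤b p∣b = p∤a-b (Signed.∣m∣n⇒∣m-n (period⇒∣b⇒∣a k pₖ₊₁ p∣b) p∣b)

  open CoprimeBases p-prime p∤a p∤b

lemma4p11 : (ℓ : ℤ) (n : ℕ) → n ≥ 2 → ¬ ((+ n) ∣ (ℓ ^ n - (ℓ - 1ℤ) ^ n))
lemma4p11 ℓ n@(suc _) 2≤n n∣diff with smallestPrimeFactor 2≤n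
... | zero  , 0-prime , _     , _   = ¬prime[0] 0-prime
... | suc _ , p-prime , rough , p∣n =
  prime-rough⇒∤^-difference p-prime rough {ℓ} {ℓ - 1ℤ} (ℓ-[ℓ-1]≡1 ℓ) (Signed.∣ᵤ⇒∣ (ℕ∣.∣-trans p∣n n∣diff))
  where
  ℓ-[ℓ-1]≡1 : ∀ ℓ → ℓ - (ℓ - 1ℤ) ≡ 1ℤ
  ℓ-[ℓ-1]≡1 = solve-∀
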